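{- Let $A$ and $B$ be interfaces. (i) If $x\in\mathrm{Sd}(A)$ and $y\in\mathrm{Sd}(B)$ then $x\times y\in\mathrm{Sd}(A\otimes B)$; (ii) if $x\in\mathrm{Sd}(A)$ and $y\in\mathrm{Sd}(B)$ then $x\times y\in\mathrm{Sd}(A\mathbin{\text{⅋}}B)$.
   Context: An interface $X$ is $(|X|,P_X)$ with $P_X$ a monotonic predicate transformer on $\mathcal{P}(|X|)$; $\mathrm{Sd}(X)=\{x\subseteq|X|\mid x\subseteq P_X(x)\}$. Dual $X^\perp=(|X|,x\mapsto\overline{P_X(\overline{x})})$; tensor $A\otimes B$ on $|A|\times|B|$ with $r\mapsto\bigcup_{x\times y\subseteq r}P_A(x)\times P_B(y)$; par $A\mathbin{\text{⅋}}B=(A^\perp\otimes B^\perp)^\perp$. -}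

module Defs where

open import Level using (Level; suc; _⊔_)
open import Data.Product using (_×_; _,_; ∃; ∃-syntax)
open import Relation.Nullary using (¬_)
open import Relation.Unary using (Pred; _⊆_; ∁)

record Interface (ℓ : Level) : Set (suc ℓ) where
  field
    Carrier : Set ℓ
    P       : Pred Carrier ℓ → Pred Carrier ℓ
    P-mono  : {x y : Pred Carrier ℓ} → x ⊆ y → P x ⊆ P y
open Interface public

Sd : ∀ {ℓ} (X : Interface ℓ) → Pred (Carrier X) ℓ → Set ℓ
Sd X x = x ⊆ P X x

_⊥ : ∀ {ℓ} → Interface ℓ → Interface ℓ
X ⊥ = record
  { Carrier = Carrier X
  ; P       = λ x → ∁ (P X (∁ x))
  ; P-mono  = λ x⊆y ¬p q → ¬p (P-mono X (λ ¬y z → ¬y (x⊆y z)) q)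
  }

_⊠_ : ∀ {ℓ} {A B : Set ℓ} → Pred A ℓ → Pred B ℓ → Pred (A × B) ℓ
(x ⊠ y) (a , b) = x a × y b

-- Tensor transformer on |A| × |B|:
--   r ↦ ⋃_{x × y ⊆ r} P_A(x) × P_B(y)
-- (the union ranges over subsets, so the result lives one level up)
P⊗ : ∀ {ℓ} (A B : Interface ℓ) →
     Pred (Carrier A × Carrier B) ℓ → Pred (Carrier A × Carrier B) (suc ℓ)
P⊗ A B r (a , b) =
  ∃[ x ] ∃[ y ] ((x ⊠ y) ⊆ r × P A x a × P B y b)

P⅋ : ∀ {ℓ} (A B : Interface ℓ) →
     Pred (Carrier A × Carrier B) ℓ → Pred (Carrier A × Carrier B) (suc ℓ)
P⅋ A B r = ∁ (P⊗ (A ⊥) (B ⊥) (∁ r))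

Sd⊗ : ∀ {ℓ} (A B : Interface ℓ) → Pred (Carrier A × Carrier B) ℓ → Set (suc ℓ)
Sd⊗ A B r = r ⊆ P⊗ A B r

Sd⅋ : ∀ {ℓ} (A B : Interface ℓ) → Pred (Carrier A × Carrier B) ℓ → Set (suc ℓ)
Sd⅋ A B r = r ⊆ P⅋ A B r

-- For ⊗ the rectangle x × y is its own witness in the union defining P_{A⊗B}.
-- For ⅋, a point (a, b) of x × y lies in P_{A⅋B}(x × y) unless some rectangle
-- u × v disjoint from x × y has a ∉ P_A(∁ u) and b ∉ P_B(∁ v).  Disjointness and
-- b ∈ y ⊆ P_B y force every a′ ∈ x out of u, so a ∈ x ⊆ P_A x ⊆ P_A(∁ u): contradiction.
module Submission where

open import Defs
open import Level using (Level)
open import Data.Product using (_×_; _,_)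
open import Function using (id)
open import Relation.Unary using (Pred; _⊆_; ∁)

module _ {ℓ : Level} (A B : Interface ℓ) where

  ⊠-Sd⊗ : ∀ {x : Pred (Carrier A) ℓ} {y : Pred (Carrier B) ℓ} →
          Sd A x → Sd B y → Sd⊗ A B (x ⊠ y)
  ⊠-Sd⊗ {x} {y} x⊆Px y⊆Py (xa , yb) = x , y , id , x⊆Px xa , y⊆Py yb

  ⊠-Sd⅋ : ∀ {x : Pred (Carrier A) ℓ} {y : Pred (Carrier B) ℓ} →
          Sd A x → Sd B y → Sd⅋ A B (x ⊠ y)
  ⊠-Sd⅋ {x} {y} x⊆Px y⊆Py {a , b} (xa , yb) (u , v , u⊠v⊆∁x⊠y , a∉P∁u , b∉P∁v) =
    a∉P∁u (P-mono A x⊆∁u (x⊆Px xa))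
    where
    x⊆∁u : x ⊆ ∁ u
    x⊆∁u {a′} xa′ ua′ = b∉P∁v (P-mono B y⊆∁v (y⊆Py yb))
      where
      y⊆∁v : y ⊆ ∁ v
      y⊆∁v {b′} yb′ vb′ = u⊠v⊆∁x⊠y (ua′ , vb′) (xa′ , yb′)

lemma5 : ∀ {ℓ : Level} (A B : Interface ℓ) →
    (∀ (x : Pred (Carrier A) ℓ) (y : Pred (Carrier B) ℓ) →
    Sd A x → Sd B y → Sd⊗ A B (x ⊠ y))
    × (∀ (x : Pred (Carrier A) ℓ) (y : Pred (Carrier B) ℓ) →
    Sd A x → Sd B y → Sd⅋ A B (x ⊠ y))
lemma5 A B = (λ _ _ → ⊠-Sd⊗ A B) , (λ _ _ → ⊠-Sd⅋ A B)
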